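{- Let $G$ and $H$ be graphs, and let $U\subseteq V(H)$ be a set of pairwise non-adjacent vertices of $H$, each of degree exactly $1$ in $H$. If $G$ can be identified to $H$, then there is an $H$-witness structure $\{W(x)\mid x\in V(H)\}$ of $G$ such that $|W(x)|=1$ for all $x\in U$.
   Context: All graphs are finite, simple and undirected. An identification of two distinct vertices $u,v$ replaces them with a new vertex adjacent to every vertex of $(N(u)\cup N(v))\setminus\{u,v\}$. A graph $G$ can be identified to a graph $H$ if $G$ can be transformed into a graph isomorphic to $H$ by a (possibly empty) sequence of identifications. An $H$-witness structure of $G$ is a partition $\{W(x)\mid x\in V(H)\}$ of $V(G)$ into sets (bags) such that every $W(x)$ is non-empty and, for distinct $x,y\in V(H)$, there is an edge of $G$ with one endpoint in $W(x)$ and the other in $W(y)$ if and only if $xy\in E(H)$. (G can be identified to H iff G has an H-witness structure.) -}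

module Defs where

open import Data.Nat using (ℕ; suc)
open import Data.Fin using (Fin; punchIn)
open import Data.Product using (Σ; ∃; ∃-syntax; _×_; _,_; proj₁; proj₂)
open import Data.Sum using (_⊎_; inj₁; inj₂)
open import Relation.Nullary using (¬_)
open import Relation.Binary.PropositionalEquality using (_≡_; _≢_; refl; sym)
open import Function.Bundles using (_↔_; Inverse)

record Graph (n : ℕ) : Set₁ where
  field
    adj     : Fin n → Fin n → Set
    adj-sym : ∀ {x y} → adj x y → adj y x
    adj-irr : ∀ {x} → ¬ adj x x
open Graph public

record _≅_ {n m : ℕ} (G : Graph n) (H : Graph m) : Set where
  field
    bij  : Fin n ↔ Fin m
  open Inverse bij public using (to)
  field
    pres : ∀ x y → adj G x y → adj H (to x) (to y)
    reflect : ∀ x y → adj H (to x) (to y) → adj G x y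

-- The new vertex set is Fin m, embedded into Fin (suc m) by punchIn v
-- (i.e. all vertices except v); the vertex at position u plays the role of the
-- new merged vertex, adjacent to every vertex of (N(u) ∪ N(v)) \ {u,v}.
identify : ∀ {m} (G : Graph (suc m)) (u v : Fin (suc m)) → u ≢ v → Graph m
identify {m} G u v _ = record { adj = A ; adj-sym = S ; adj-irr = I }
  where
  A : Fin m → Fin m → Set
  A a b = (a ≢ b) ×
          (adj G (punchIn v a) (punchIn v b)
           ⊎ (punchIn v a ≡ u × adj G v (punchIn v b))
           ⊎ (punchIn v b ≡ u × adj G (punchIn v a) v))
  S : ∀ {a b} → A a b → A b a
  S (ne , inj₁ e) = (λ eq → ne (sym eq)) , inj₁ (adj-sym G e)
  S (ne , inj₂ (inj₁ (p , e))) = (λ eq → ne (sym eq)) , inj₂ (inj₂ (p , adj-sym G e))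
  S (ne , inj₂ (inj₂ (p , e))) = (λ eq → ne (sym eq)) , inj₂ (inj₁ (p , adj-sym G e))
  I : ∀ {a} → ¬ A a a
  I (ne , _) = ne refl

data CanIdentifyTo : ∀ {n m} → Graph n → Graph m → Set₁ where
  done : ∀ {n m} {G : Graph n} {H : Graph m} → G ≅ H → CanIdentifyTo G H
  step : ∀ {n m} {G : Graph (suc n)} {H : Graph m} (u v : Fin (suc n)) (uv : u ≢ v)
       → CanIdentifyTo (identify G u v uv) H → CanIdentifyTo G H

-- An H-witness structure of G, given by the bag map w : V(G) → V(H)
-- (W(x) = w⁻¹(x)); bags are non-empty, and for distinct x, y there is an
-- edge between W(x) and W(y) iff xy ∈ E(H).
record WitnessStructure {n m : ℕ} (G : Graph n) (H : Graph m) : Set where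
  field
    bag      : Fin n → Fin m
    nonempty : ∀ x → ∃[ u ] bag u ≡ x
    edges    : ∀ x y → x ≢ y →
               ((∃[ u ] ∃[ v ] (bag u ≡ x × bag v ≡ y × adj G u v)) → adj H x y)
               × (adj H x y → ∃[ u ] ∃[ v ] (bag u ≡ x × bag v ≡ y × adj G u v))
open WitnessStructure public

Degree1 : ∀ {m} → Graph m → Fin m → Set
Degree1 H x = ∃[ y ] (adj H x y × (∀ z → adj H x z → z ≡ y))

SingletonBag : ∀ {n m} {G : Graph n} {H : Graph m} → WitnessStructure G H → Fin m → Set
SingletonBag W x = ∃[ u ] (bag W u ≡ x × (∀ u' → bag W u' ≡ x → u' ≡ u))

module Submission where

-- Identifications compose, so a sequence of them followed by an isomorphism
-- yields some H-witness structure W of G.  To make the bag of a pendant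
-- vertex x ∈ U a singleton, keep one vertex a of W(x) that has a neighbour in
-- the bag of the unique neighbour y of x, and move the rest of W(x) into W(y).
-- Since y ∉ U (U is independent) and x has no other neighbour, no edge
-- between bags is created or lost.

open import Defs
open import Data.Nat using (ℕ; suc)
open import Data.Fin using (Fin; punchIn; punchOut; _≟_)
open import Data.Fin.Properties
  using (punchIn-injective; punchOut-punchIn; punchIn-punchOut; punchInᵢ≢i; punchOut-cong′)
open import Data.Fin.Subset using (Subset; _∈_; _∉_)
open import Data.Fin.Subset.Properties using (_∈?_)
open import Data.Vec.Properties.WithK using ([]=-irrelevant)
open import Data.Product using (Σ; ∃-syntax; _×_; _,_; proj₁; proj₂)
open import Data.Sum using (_⊎_; inj₁; inj₂)
open import Data.Empty using (⊥-elim)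
open import Relation.Nullary using (¬_; yes; no)
open import Relation.Binary.PropositionalEquality
open import Function.Bundles using (Inverse)

Linked : ∀ {n m} → Graph n → (Fin n → Fin m) → Fin m → Fin m → Set
Linked G b x y = ∃[ u ] ∃[ v ] (b u ≡ x × b v ≡ y × adj G u v)

Linked-sym : ∀ {n m} (G : Graph n) {b : Fin n → Fin m} {x y} →
             Linked G b x y → Linked G b y x
Linked-sym G (u , v , bu , bv , e) = v , u , bv , bu , adj-sym G e

mkWitnessStructure : ∀ {n m} {G : Graph n} {H : Graph m} (b : Fin n → Fin m) →
  (∀ x → ∃[ u ] b u ≡ x) →
  (∀ x y → x ≢ y → Linked G b x y → adj H x y) →
  (∀ x y → adj H x y → Linked G b x y) →
  WitnessStructure G H
mkWitnessStructure b surj sound complete = record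
  { bag = b ; nonempty = surj ; edges = λ x y x≢y → sound x y x≢y , complete x y }

≅⇒WitnessStructure : ∀ {n m} {G : Graph n} {H : Graph m} → G ≅ H → WitnessStructure G H
≅⇒WitnessStructure {G = G} {H} G≅H = mkWitnessStructure to surj sound complete
  where
  open _≅_ G≅H
  open Inverse bij using (from; strictlyInverseˡ)

  surj : ∀ x → ∃[ u ] to u ≡ x
  surj x = from x , strictlyInverseˡ x

  sound : ∀ x y → x ≢ y → Linked G to x y → adj H x y
  sound _ _ _ (u , v , refl , refl , e) = pres u v e

  complete : ∀ x y → adj H x y → Linked G to x y
  complete x y e = from x , from y , strictlyInverseˡ x , strictlyInverseˡ y ,
    reflect (from x) (from y)
      (subst₂ (adj H) (sym (strictlyInverseˡ x)) (sym (strictlyInverseˡ y)) e)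

WitnessStructure-trans : ∀ {n k m} {G : Graph n} {K : Graph k} {H : Graph m} →
  WitnessStructure G K → WitnessStructure K H → WitnessStructure G H
WitnessStructure-trans {n} {m = m} {G} {K} {H} W V = mkWitnessStructure b surj sound complete
  where
  b : Fin n → Fin m
  b u = bag V (bag W u)

  surj : ∀ x → ∃[ u ] b u ≡ x
  surj x with nonempty V x
  ... | p , refl with nonempty W p
  ...   | u , refl = u , refl

  sound : ∀ x y → x ≢ y → Linked G b x y → adj H x y
  sound _ _ x≢y (u , v , refl , refl , e) =
    proj₁ (edges V _ _ x≢y) (bag W u , bag W v , refl , refl ,
      proj₁ (edges W _ _ (λ eq → x≢y (cong (bag V) eq))) (u , v , refl , refl , e))

  complete : ∀ x y → adj H x y → Linked G b x y
  complete x y e with proj₂ (edges V x y (λ { refl → adj-irr H e })) e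
  ... | p , q , refl , refl , e′ with proj₂ (edges W p q (λ { refl → adj-irr K e′ })) e′
  ...   | u , v , refl , refl , e″ = u , v , refl , refl , e″

module Identification {m} (G : Graph (suc m)) (u v : Fin (suc m)) (u≢v : u ≢ v) where

  -- In identify G u v, the vertex w of the new graph stands for punchIn v w;
  -- the merged vertex is the one standing for u.
  merged : Fin m
  merged = punchOut (λ v≡u → u≢v (sym v≡u))

  punchIn-merged : punchIn v merged ≡ u
  punchIn-merged = punchIn-punchOut _

  merge : Fin (suc m) → Fin m
  merge a with v ≟ a
  ... | yes _   = merged
  ... | no  v≢a = punchOut v≢a

  merge-v : merge v ≡ merged
  merge-v with v ≟ v
  ... | yes _   = refl
  ... | no  v≢v = ⊥-elim (v≢v refl)

  merge-punchIn : ∀ w → merge (punchIn v w) ≡ w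
  merge-punchIn w with v ≟ punchIn v w
  ... | yes v≡w = ⊥-elim (punchInᵢ≢i v w (sym v≡w))
  ... | no  _   = trans (punchOut-cong′ v refl) (punchOut-punchIn v)

  merge-cases : ∀ a → a ≡ v ⊎ a ≡ punchIn v (merge a)
  merge-cases a with v ≟ a
  ... | yes v≡a = inj₁ (sym v≡a)
  ... | no  v≢a = inj₂ (sym (punchIn-punchOut v≢a))

  merge-v≡ : ∀ w → punchIn v w ≡ u → merge v ≡ w
  merge-v≡ w eq = trans merge-v (punchIn-injective v merged w (trans punchIn-merged (sym eq)))

  witnessStructure : WitnessStructure G (identify G u v u≢v)
  witnessStructure = mkWitnessStructure merge (λ w → punchIn v w , merge-punchIn w) sound complete
    where
    sound : ∀ x y → x ≢ y → Linked G merge x y → adj (identify G u v u≢v) x y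
    sound _ _ x≢y (a , b , refl , refl , e) with merge-cases a | merge-cases b
    ... | inj₁ refl | inj₁ refl = ⊥-elim (adj-irr G e)
    ... | inj₁ refl | inj₂ b≡ =
      x≢y , inj₂ (inj₁ (trans (cong (punchIn v) merge-v) punchIn-merged , subst (adj G v) b≡ e))
    ... | inj₂ a≡ | inj₁ refl =
      x≢y , inj₂ (inj₂ (trans (cong (punchIn v) merge-v) punchIn-merged , subst (λ z → adj G z v) a≡ e))
    ... | inj₂ a≡ | inj₂ b≡ = x≢y , inj₁ (subst₂ (adj G) a≡ b≡ e)

    complete : ∀ x y → adj (identify G u v u≢v) x y → Linked G merge x y
    complete x y (_ , inj₁ e) = punchIn v x , punchIn v y , merge-punchIn x , merge-punchIn y , e
    complete x y (_ , inj₂ (inj₁ (x≡u , e))) = v , punchIn v y , merge-v≡ x x≡u , merge-punchIn y , e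
    complete x y (_ , inj₂ (inj₂ (y≡u , e))) = punchIn v x , v , merge-punchIn x , merge-v≡ y y≡u , e

CanIdentifyTo⇒WitnessStructure : ∀ {n m} {G : Graph n} {H : Graph m} →
  CanIdentifyTo G H → WitnessStructure G H
CanIdentifyTo⇒WitnessStructure (done G≅H) = ≅⇒WitnessStructure G≅H
CanIdentifyTo⇒WitnessStructure (step {G = G} u v u≢v G′↝H) =
  WitnessStructure-trans (Identification.witnessStructure G u v u≢v)
                         (CanIdentifyTo⇒WitnessStructure G′↝H)

module PendantBags {n m} {G : Graph n} {H : Graph m} (U : Subset m)
  (independent : ∀ x y → x ∈ U → y ∈ U → ¬ adj H x y)
  (pendant : ∀ x → x ∈ U → Degree1 H x)
  (W : WitnessStructure G H) where

  partner : ∀ x → x ∈ U → Fin m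
  partner x p = proj₁ (pendant x p)

  partner-adj : ∀ x p → adj H x (partner x p)
  partner-adj x p = proj₁ (proj₂ (pendant x p))

  partner-unique : ∀ x p {y} → adj H x y → y ≡ partner x p
  partner-unique x p = proj₂ (proj₂ (pendant x p)) _

  partner-∉ : ∀ x p → partner x p ∉ U
  partner-∉ x p q = independent x (partner x p) p q (partner-adj x p)

  partner-cong : ∀ {x y} (p : x ∈ U) (q : y ∈ U) → x ≡ y → partner x p ≡ partner y q
  partner-cong p q refl rewrite []=-irrelevant p q = refl

  sound : ∀ {a b} → bag W a ≢ bag W b → adj G a b → adj H (bag W a) (bag W b)
  sound ne e = proj₁ (edges W _ _ ne) (_ , _ , refl , refl , e)

  complete : ∀ {x y} → adj H x y → Linked G (bag W) x y
  complete {x} {y} e = proj₂ (edges W x y (λ { refl → adj-irr H e })) e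

  anchorEdge : ∀ x p → Linked G (bag W) x (partner x p)
  anchorEdge x p = complete (partner-adj x p)

  anchor : ∀ x → x ∈ U → Fin n
  anchor x p = proj₁ (anchorEdge x p)

  anchor-bag : ∀ x p → bag W (anchor x p) ≡ x
  anchor-bag x p = proj₁ (proj₂ (proj₂ (anchorEdge x p)))

  anchor′ : ∀ x → x ∈ U → Fin n
  anchor′ x p = proj₁ (proj₂ (anchorEdge x p))

  anchor′-bag : ∀ x p → bag W (anchor′ x p) ≡ partner x p
  anchor′-bag x p = proj₁ (proj₂ (proj₂ (proj₂ (anchorEdge x p))))

  anchor-adj : ∀ x p → adj G (anchor x p) (anchor′ x p)
  anchor-adj x p = proj₂ (proj₂ (proj₂ (proj₂ (anchorEdge x p))))

  anchor-cong : ∀ {x y} (p : x ∈ U) (q : y ∈ U) → x ≡ y → anchor x p ≡ anchor y q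
  anchor-cong p q refl rewrite []=-irrelevant p q = refl

  bag′ : Fin n → Fin m
  bag′ a with bag W a ∈? U
  ... | no  _ = bag W a
  ... | yes p with a ≟ anchor (bag W a) p
  ...   | yes _ = bag W a
  ...   | no  _ = partner (bag W a) p

  bag′-cases : ∀ a → bag′ a ≡ bag W a ⊎ Σ (bag W a ∈ U) (λ p → bag′ a ≡ partner (bag W a) p)
  bag′-cases a with bag W a ∈? U
  ... | no  _ = inj₁ refl
  ... | yes p with a ≟ anchor (bag W a) p
  ...   | yes _ = inj₁ refl
  ...   | no  _ = inj₂ (p , refl)

  bag′-∉ : ∀ a → bag W a ∉ U → bag′ a ≡ bag W a
  bag′-∉ a a∉U with bag W a ∈? U
  ... | no  _ = refl
  ... | yes p = ⊥-elim (a∉U p)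

  bag′-anchor : ∀ x p → bag′ (anchor x p) ≡ x
  bag′-anchor x p with bag W (anchor x p) ∈? U
  ... | no  _ = anchor-bag x p
  ... | yes q with anchor x p ≟ anchor (bag W (anchor x p)) q
  ...   | yes _ = anchor-bag x p
  ...   | no  ne = ⊥-elim (ne (anchor-cong p q (sym (anchor-bag x p))))

  bag′-only-anchor : ∀ x p a → bag′ a ≡ x → a ≡ anchor x p
  bag′-only-anchor x p a eq with bag W a ∈? U
  ... | no  a∉U = ⊥-elim (a∉U (subst (_∈ U) (sym eq) p))
  ... | yes q with a ≟ anchor (bag W a) q
  ...   | yes a≡ = trans a≡ (anchor-cong q p eq)
  ...   | no  _  = ⊥-elim (partner-∉ (bag W a) q (subst (_∈ U) (sym eq) p))

  bag′-anchor′ : ∀ x p → bag′ (anchor′ x p) ≡ partner x p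
  bag′-anchor′ x p =
    trans (bag′-∉ (anchor′ x p) (λ q → partner-∉ x p (subst (_∈ U) (anchor′-bag x p) q)))
          (anchor′-bag x p)

  moved-unchanged : ∀ {a b} (p : bag W a ∈ U) → bag′ a ≡ partner (bag W a) p → bag′ b ≡ bag W b →
                    bag′ a ≢ bag′ b → adj G a b → adj H (bag′ a) (bag′ b)
  moved-unchanged {a} {b} p a↦ b↦ ne e with bag W b ≟ bag W a
  ... | yes b≡a = subst₂ (adj H) (sym a↦) (trans (sym b≡a) (sym b↦)) (adj-sym H (partner-adj _ p))
  ... | no  b≢a = ⊥-elim (ne (trans a↦ (trans (sym (partner-unique _ p (sound (λ eq → b≢a (sym eq)) e)))
                                              (sym b↦))))

  moved-moved : ∀ {a b} (p : bag W a ∈ U) (q : bag W b ∈ U) →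
                bag′ a ≡ partner (bag W a) p → bag′ b ≡ partner (bag W b) q →
                bag′ a ≢ bag′ b → ¬ adj G a b
  moved-moved {a} {b} p q a↦ b↦ ne e with bag W a ≟ bag W b
  ... | yes a≡b = ne (trans a↦ (trans (partner-cong p q a≡b) (sym b↦)))
  ... | no  a≢b = independent _ _ p q (sound a≢b e)

  sound′ : ∀ {a b} → bag′ a ≢ bag′ b → adj G a b → adj H (bag′ a) (bag′ b)
  sound′ {a} {b} ne e with bag′-cases a | bag′-cases b
  ... | inj₁ a↦ | inj₁ b↦ =
    subst₂ (adj H) (sym a↦) (sym b↦) (sound (λ eq → ne (trans a↦ (trans eq (sym b↦)))) e)
  ... | inj₂ (p , a↦) | inj₁ b↦ = moved-unchanged p a↦ b↦ ne e
  ... | inj₁ a↦ | inj₂ (q , b↦) =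
    adj-sym H (moved-unchanged q b↦ a↦ (λ eq → ne (sym eq)) (adj-sym G e))
  ... | inj₂ (p , a↦) | inj₂ (q , b↦) = ⊥-elim (moved-moved p q a↦ b↦ ne e)

  complete-∈ : ∀ x p {y} → adj H x y → Linked G bag′ x y
  complete-∈ x p e = anchor x p , anchor′ x p , bag′-anchor x p ,
    trans (bag′-anchor′ x p) (sym (partner-unique x p e)) , anchor-adj x p

  complete′ : ∀ x y → adj H x y → Linked G bag′ x y
  complete′ x y e with x ∈? U | y ∈? U
  ... | yes p | _     = complete-∈ x p e
  ... | no  _ | yes q = Linked-sym G (complete-∈ y q (adj-sym H e))
  ... | no x∉ | no y∉ with complete e
  ...   | a , b , refl , refl , e′ = a , b , bag′-∉ a x∉ , bag′-∉ b y∉ , e′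

  surj′ : ∀ x → ∃[ a ] bag′ a ≡ x
  surj′ x with x ∈? U
  ... | yes p = anchor x p , bag′-anchor x p
  ... | no x∉ with nonempty W x
  ...   | a , refl = a , bag′-∉ a x∉

  witnessStructure : WitnessStructure G H
  witnessStructure = mkWitnessStructure bag′ surj′
    (λ { _ _ ne (a , b , refl , refl , e) → sound′ ne e }) complete′

  singleton : ∀ x → x ∈ U → SingletonBag witnessStructure x
  singleton x p = anchor x p , bag′-anchor x p , bag′-only-anchor x p

lemma2p1 : ∀ {n m : ℕ} (G : Graph n) (H : Graph m) (U : Subset m)
    → (∀ x y → x ∈ U → y ∈ U → ¬ adj H x y)
    → (∀ x → x ∈ U → Degree1 H x)
    → CanIdentifyTo G H
    → Σ (WitnessStructure G H) (λ W → ∀ x → x ∈ U → SingletonBag W x)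
lemma2p1 G H U independent pendant G↝H = witnessStructure , singleton
  where open PendantBags U independent pendant (CanIdentifyTo⇒WitnessStructure G↝H)
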